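{- Let $p$ be a prime, $n\ge1$, and $F=\prod_{\nu=1}^n f_\nu$ with $f_\nu\in\mathcal{K}_{p,2}$ and $\lambda_{f_\nu}<\infty$ for all $\nu$. Put $m=\sum_{\nu=1}^n\lambda_{f_\nu}$. Then $F\in\mathcal{K}_{p,2}$, $\lambda_F\ge m$, and \[ \Delta_F(m)\equiv\binom{m}{\lambda_{f_1},\ldots,\lambda_{f_n}}\prod_{\nu=1}^n\Delta_{f_\nu}(\lambda_{f_\nu})\pmod{p\mathbb{Z}_p}. \] Moreover, $\lambda_F>m$ if and only if the multinomial coefficient $\binom{m}{\lambda_{f_1},\ldots,\lambda_{f_n}}$ lies in $p\mathbb{Z}_p$.
   Context: Let $\Delta^n f(s)=\sum_{\nu=0}^n\binom{n}{\nu}(-1)^{n-\nu}f(s+\nu)$. $\mathcal{K}_{p,2}$ is the set of $f:\mathbb{Z}_p\to\mathbb{Z}_p$ with $\Delta^n f(s)\equiv0\pmod{p^n\mathbb{Z}_p}$ for all $s\in\mathbb{Z}_p$, $n\ge0$. For $f\in\mathcal{K}_{p,2}$, $\Delta_f(k)=\Delta^kf(0)/p^k\in\mathbb{Z}_p$, and $\lambda_f=\min\{k\ge0:\Delta_f(k)\in\mathbb{Z}_p^*\}$, with $\lambda_f=\infty$ if no such $k$ exists. -}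

module Defs where

open import Data.Nat as ℕ using (ℕ; zero; suc; _∸_; NonZero)
open import Data.Nat.Properties using (m^n≢0)
open import Data.Nat.Combinatorics using (_C_)
open import Data.Integer as ℤ using (ℤ; +_; 0ℤ; 1ℤ; -1ℤ; _-_; _/ℕ_)
open import Data.Integer.Divisibility using (_∣_)
open import Data.Fin using (Fin)
import Data.Fin as Fin
open import Data.Product using (_×_)
open import Relation.Nullary using (¬_)

sumℕ : (n : ℕ) → (Fin n → ℕ) → ℕ
sumℕ zero    a = 0
sumℕ (suc n) a = a Fin.zero ℕ.+ sumℕ n (λ i → a (Fin.suc i))

prodℤ : (n : ℕ) → (Fin n → ℤ) → ℤ
prodℤ zero    a = 1ℤ
prodℤ (suc n) a = a Fin.zero ℤ.* prodℤ n (λ i → a (Fin.suc i))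

sumTo : ℕ → (ℕ → ℤ) → ℤ
sumTo zero    a = a 0
sumTo (suc n) a = sumTo n a ℤ.+ a (suc n)

-- multinomial coefficient (m ; a_0,...,a_{n-1}) with m = Σ a_i,
-- as the product of binomials C(a_0 + ... + a_{n-1}, a_0) * (a_1 ; ...)
multinomial : (n : ℕ) → (Fin n → ℕ) → ℕ
multinomial zero    a = 1
multinomial (suc n) a =
  ((a Fin.zero ℕ.+ sumℕ n (λ i → a (Fin.suc i))) C a Fin.zero)
    ℕ.* multinomial n (λ i → a (Fin.suc i))

-- p-adic integers, represented by sequences of integers (x k) with
-- x (k+1) ≡ x k mod p^k; the represented element is lim x k.
Seq : Set
Seq = ℕ → ℤ

IsZp : ℕ → Seq → Set
IsZp p x = ∀ k → (+ (p ℕ.^ k)) ∣ (x (suc k) - x k)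

_≈[_]_ : Seq → ℕ → Seq → Set
x ≈[ p ] y = ∀ k → (+ (p ℕ.^ k)) ∣ (x k - y k)

InPow : ℕ → ℕ → Seq → Set
InPow p n x = (+ (p ℕ.^ n)) ∣ x n

CongPow : ℕ → ℕ → Seq → Seq → Set
CongPow p n x y = (+ (p ℕ.^ n)) ∣ (x n - y n)

Unit : ℕ → Seq → Set
Unit p x = ¬ ((+ p) ∣ x 1)

const : ℕ → Seq
const ν = λ _ → + ν

shift : Seq → ℕ → Seq
shift s ν = λ k → s k ℤ.+ + ν

ZpFun : ℕ → (Seq → Seq) → Set
ZpFun p f = (∀ x → IsZp p x → IsZp p (f x))
          × (∀ x y → IsZp p x → IsZp p y → x ≈[ p ] y → f x ≈[ p ] f y)

ΔPow : (Seq → Seq) → ℕ → Seq → Seq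
ΔPow f n s = λ k → sumTo n (λ ν → (+ (n C ν)) ℤ.* (-1ℤ ℤ.^ (n ∸ ν)) ℤ.* f (shift s ν) k)

K : ℕ → (Seq → Seq) → Set
K p f = ZpFun p f × (∀ s → IsZp p s → ∀ n → InPow p n (ΔPow f n s))

-- Δ_f(k) = Δ^k f(0) / p^k  (exact division in ℤ_p when Δ^k f(0) ∈ p^k ℤ_p)
Δf : (p : ℕ) → .{{NonZero p}} → (Seq → Seq) → ℕ → Seq
Δf p f k = λ j → _/ℕ_ (ΔPow f k (const 0) (j ℕ.+ k)) (p ℕ.^ k) {{m^n≢0 p k}}

-- λ_f = k  (least k with Δ_f(k) a unit);  λ_f = ∞ iff no such k
IsLambda : (p : ℕ) → .{{NonZero p}} → (Seq → Seq) → ℕ → Set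
IsLambda p f k = Unit p (Δf p f k) × (∀ j → j ℕ.< k → ¬ Unit p (Δf p f j))

prodFun : (n : ℕ) → (Fin n → Seq → Seq) → Seq → Seq
prodFun n f s = λ k → prodℤ n (λ ν → f ν s k)

module Submission where

-- Everything is reduced to integer sequences.  Read at a fixed p-adic
-- precision M, t ↦ f(t) is an integer sequence a, and the paper's Δ^r f(0)
-- becomes the iterated difference Δ^r a(0) (binomial formula).  When
-- λ_f = l, a has a divisibility profile (p^(r+1) ∣ Δ^r a(0) for r < l and
-- p^r ∣ Δ^r a(0) for l ≤ r ≤ M) and a leading term
-- Δ^l a(0) ≡ p^l Δ_f(l) (mod p^(l+1)).  Both are transported to pointwise
-- products by induction on r through the Leibniz rule Δ(ab) = Δa·σb + a·Δb;
-- Pascal's rule yields the factor C(l+m, l), and iterating over the factors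
-- the multinomial coefficient.  Reading the leading p-adic digit off the
-- product then gives the congruence, the bound λ_F ≥ m, and the criterion
-- for λ_F > m.

open import Defs
open import Data.Nat using (ℕ; NonZero; _≤_; _<_)
open import Data.Nat.Divisibility using (_∣_)
open import Data.Nat.Primality using (Prime)
open import Data.Integer using (+_; _*_)
open import Data.Fin using (Fin)
open import Data.Product using (_×_)
open import Function.Bundles using (_⇔_)

import Data.Nat as ℕ
open import Data.Nat using (zero; suc; _∸_; z≤n; s≤s)
import Data.Nat.Properties as ℕP
import Data.Nat.Divisibility as ℕ∣
import Data.Nat.Tactic.RingSolver as ℕSolver
import Function.Properties.Equivalence as ⇔
open import Data.Nat.Combinatorics
  using (_C_; nCk+nC[k+1]≡[n+1]C[k+1]; nCk≡nC[n∸k]; k>n⇒nCk≡0)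
open import Data.Nat.Primality using (euclidsLemma; ¬prime[1])
open import Data.Integer using (ℤ; 0ℤ; 1ℤ; -1ℤ; _+_; _-_; -_; _^_; _/ℕ_; _%ℕ_; ∣_∣)
import Data.Integer.Properties as ℤP
open import Data.Integer.DivMod using (a≡a%ℕn+[a/ℕn]*n; n%ℕd<d)
open import Data.Integer.Divisibility.Signed
  using (divides; ∣-refl; ∣-trans; ∣m∣n⇒∣m+n; ∣m∣n⇒∣m-n; ∣m+n∣m⇒∣n;
         ∣n⇒∣m*n; ∣m⇒∣m*n; *-monoʳ-∣; *-monoˡ-∣; *-cancelˡ-∣; ∣ᵤ⇒∣; ∣⇒∣ᵤ)
  renaming (_∣_ to _∣ℤ_)
open import Data.Integer.Tactic.RingSolver using (solve-∀)
import Data.Fin as Fin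
open import Data.Product using (_,_; proj₁; proj₂)
open import Data.Sum using (_⊎_; inj₁; inj₂)
open import Data.Empty using (⊥-elim)
open import Function.Bundles using (mk⇔; Equivalence)
open Equivalence using (to; from)
open import Function.Base using (_∘_)
open import Relation.Nullary using (¬_; yes; no)
open import Relation.Nullary.Decidable using (decidable-stable)
open import Relation.Binary.PropositionalEquality hiding ([_])

Δ : (ℕ → ℤ) → ℕ → ℤ
Δ a t = a (suc t) - a t

σ : (ℕ → ℤ) → ℕ → ℤ
σ a t = a (suc t)

_⊙_ : (ℕ → ℤ) → (ℕ → ℤ) → ℕ → ℤ
(a ⊙ b) t = a t * b t

diff : ℕ → (ℕ → ℤ) → ℤ
diff zero    a = a 0
diff (suc r) a = diff r (Δ a)

diff-cong : ∀ r {a b} → (∀ t → a t ≡ b t) → diff r a ≡ diff r b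
diff-cong zero    a≡b = a≡b 0
diff-cong (suc r) a≡b = diff-cong r (λ t → cong₂ _-_ (a≡b (suc t)) (a≡b t))

diff-+ : ∀ r a b → diff r (λ t → a t + b t) ≡ diff r a + diff r b
diff-+ zero    a b = refl
diff-+ (suc r) a b =
  trans (diff-cong r (λ t → regroup (a (suc t)) (b (suc t)) (a t) (b t)))
        (diff-+ r (Δ a) (Δ b))
  where
  regroup : ∀ w x y z → (w + x) - (y + z) ≡ (w - y) + (x - z)
  regroup = solve-∀

diff-- : ∀ r a b → diff r (λ t → a t - b t) ≡ diff r a - diff r b
diff-- zero    a b = refl
diff-- (suc r) a b =
  trans (diff-cong r (λ t → regroup (a (suc t)) (b (suc t)) (a t) (b t)))
        (diff-- r (Δ a) (Δ b))
  where
  regroup : ∀ w x y z → (w - x) - (y - z) ≡ (w - y) - (x - z)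
  regroup = solve-∀

-- Δ^r(σa)(0) = Δ^r a(0) + Δ^(r+1) a(0), since σa = a + Δa
diff-σ : ∀ r a → diff r (σ a) ≡ diff r a + diff (suc r) a
diff-σ r a = trans (diff-cong r (λ t → split (a (suc t)) (a t))) (diff-+ r a (Δ a))
  where
  split : ∀ x y → x ≡ y + (x - y)
  split = solve-∀

leibniz : ∀ r a b → diff (suc r) (a ⊙ b) ≡ diff r (Δ a ⊙ σ b) + diff r (a ⊙ Δ b)
leibniz r a b =
  trans (diff-cong r (λ t → product-rule (a (suc t)) (b (suc t)) (a t) (b t)))
        (diff-+ r _ _)
  where
  product-rule : ∀ x y z w → x * y - z * w ≡ (x - z) * y + z * (y - w)
  product-rule = solve-∀

diff-const : ∀ r x → diff (suc r) (λ _ → x) ≡ 0ℤ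
diff-const zero    x = ℤP.+-inverseʳ x
diff-const (suc r) x =
  trans (diff-cong (suc r) (λ _ → ℤP.+-inverseʳ x)) (diff-const r 0ℤ)

-- The binomial formula Δ^n a(0) = Σ_ν C(n,ν)(-1)^(n-ν) a(ν)

sumTo-cong : ∀ n {x y : ℕ → ℤ} → (∀ ν → ν ≤ n → x ν ≡ y ν) → sumTo n x ≡ sumTo n y
sumTo-cong zero    x≡y = x≡y 0 z≤n
sumTo-cong (suc n) x≡y =
  cong₂ _+_ (sumTo-cong n (λ ν ν≤n → x≡y ν (ℕP.m≤n⇒m≤1+n ν≤n))) (x≡y (suc n) ℕP.≤-refl)

sumTo-+ : ∀ n x y → sumTo n (λ ν → x ν + y ν) ≡ sumTo n x + sumTo n y
sumTo-+ zero    x y = refl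
sumTo-+ (suc n) x y =
  trans (cong (_+ (x (suc n) + y (suc n))) (sumTo-+ n x y))
        (regroup (sumTo n x) (sumTo n y) (x (suc n)) (y (suc n)))
  where
  regroup : ∀ a b c d → (a + b) + (c + d) ≡ (a + c) + (b + d)
  regroup = solve-∀

sumTo-neg : ∀ n x → sumTo n (λ ν → - x ν) ≡ - sumTo n x
sumTo-neg zero    x = refl
sumTo-neg (suc n) x =
  trans (cong (_+ (- x (suc n))) (sumTo-neg n x))
        (sym (ℤP.neg-distrib-+ (sumTo n x) (x (suc n))))

sumTo-head : ∀ n x → sumTo (suc n) x ≡ x 0 + sumTo n (λ ν → x (suc ν))
sumTo-head zero    x = refl
sumTo-head (suc n) x =
  trans (cong (_+ x (suc (suc n))) (sumTo-head n x)) (ℤP.+-assoc (x 0) _ _)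

coeff : ℕ → ℕ → ℤ
coeff n ν = + (n C ν) * (-1ℤ ^ (n ∸ ν))

binomialSum : ℕ → (ℕ → ℤ) → ℤ
binomialSum n a = sumTo n (λ ν → coeff n ν * a ν)

coeff-pascal : ∀ n ν → coeff (suc n) (suc ν) ≡ coeff n ν + + (n C suc ν) * (-1ℤ ^ (n ∸ ν))
coeff-pascal n ν = begin
    + (suc n C suc ν) * sign
  ≡⟨ cong (λ c → + c * sign) (sym (nCk+nC[k+1]≡[n+1]C[k+1] n ν)) ⟩
    + (n C ν ℕ.+ n C suc ν) * sign
  ≡⟨ cong (_* sign) (ℤP.pos-+ (n C ν) (n C suc ν)) ⟩
    (+ (n C ν) + + (n C suc ν)) * sign
  ≡⟨ ℤP.*-distribʳ-+ sign (+ (n C ν)) (+ (n C suc ν)) ⟩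
    coeff n ν + + (n C suc ν) * sign
  ∎
  where
  open ≡-Reasoning
  sign : ℤ
  sign = -1ℤ ^ (n ∸ ν)

-- The part of the order-(n+1) sum coming from the coefficients C(n, ν):
-- these are the terms C(n,ν)(-1)^(n+1-ν) a(ν), ν ≤ n+1, i.e. minus the
-- order-n sum, the term ν = n+1 vanishing.
binomialSum-lower : ∀ n a →
  coeff (suc n) 0 * a 0 + sumTo n (λ ν → + (n C suc ν) * (-1ℤ ^ (n ∸ ν)) * a (suc ν))
    ≡ - binomialSum n a
binomialSum-lower n a = begin
    coeff (suc n) 0 * a 0 + sumTo n (λ ν → lowered (suc ν))
  ≡⟨ sym (sumTo-head n lowered) ⟩
    sumTo n lowered + + (n C suc n) * (-1ℤ ^ (n ∸ n)) * a (suc n)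
  ≡⟨ cong (λ c → sumTo n lowered + + c * (-1ℤ ^ (n ∸ n)) * a (suc n))
          (k>n⇒nCk≡0 (ℕP.n<1+n n)) ⟩
    sumTo n lowered + 0ℤ
  ≡⟨ ℤP.+-identityʳ _ ⟩
    sumTo n lowered
  ≡⟨ sumTo-cong n lowered≡ ⟩
    sumTo n (λ ν → - (coeff n ν * a ν))
  ≡⟨ sumTo-neg n _ ⟩
    - binomialSum n a
  ∎
  where
  open ≡-Reasoning
  lowered : ℕ → ℤ
  lowered ν = + (n C ν) * (-1ℤ ^ (suc n ∸ ν)) * a ν
  flip-sign : ∀ c s x → c * (-1ℤ * s) * x ≡ - (c * s * x)
  flip-sign = solve-∀
  lowered≡ : ∀ ν → ν ≤ n → lowered ν ≡ - (coeff n ν * a ν)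
  lowered≡ ν ν≤n =
    trans (cong (λ e → + (n C ν) * (-1ℤ ^ e) * a ν) (ℕP.+-∸-assoc 1 ν≤n))
          (flip-sign (+ (n C ν)) (-1ℤ ^ (n ∸ ν)) (a ν))

-- splitting the coefficients by Pascal's rule turns the binomial sum of
-- order n+1 into a difference of two binomial sums of order n
binomialSum-step : ∀ n a → binomialSum (suc n) a ≡ binomialSum n (σ a) - binomialSum n a
binomialSum-step n a = begin
    binomialSum (suc n) a
  ≡⟨ sumTo-head n (λ ν → coeff (suc n) ν * a ν) ⟩
    first + sumTo n (λ ν → coeff (suc n) (suc ν) * a (suc ν))
  ≡⟨ cong (λ z → first + z) (trans (sumTo-cong n (λ ν _ → split ν)) (sumTo-+ n _ _)) ⟩
    first + (binomialSum n (σ a) + rest)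
  ≡⟨ swap first (binomialSum n (σ a)) rest ⟩
    binomialSum n (σ a) + (first + rest)
  ≡⟨ cong (λ z → binomialSum n (σ a) + z) (binomialSum-lower n a) ⟩
    binomialSum n (σ a) - binomialSum n a
  ∎
  where
  open ≡-Reasoning
  first rest : ℤ
  first = coeff (suc n) 0 * a 0
  rest = sumTo n (λ ν → + (n C suc ν) * (-1ℤ ^ (n ∸ ν)) * a (suc ν))
  swap : ∀ x y z → x + (y + z) ≡ y + (x + z)
  swap = solve-∀
  split : ∀ ν → coeff (suc n) (suc ν) * a (suc ν)
              ≡ coeff n ν * a (suc ν) + + (n C suc ν) * (-1ℤ ^ (n ∸ ν)) * a (suc ν)
  split ν = trans (cong (_* a (suc ν)) (coeff-pascal n ν))
                  (ℤP.*-distribʳ-+ (a (suc ν)) (coeff n ν) _)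

binomialSum≡diff : ∀ n a → binomialSum n a ≡ diff n a
binomialSum≡diff zero    a = ℤP.*-identityˡ (a 0)
binomialSum≡diff (suc n) a = begin
    binomialSum (suc n) a
  ≡⟨ binomialSum-step n a ⟩
    binomialSum n (σ a) - binomialSum n a
  ≡⟨ cong₂ _-_ (binomialSum≡diff n (σ a)) (binomialSum≡diff n a) ⟩
    diff n (σ a) - diff n a
  ≡⟨ sym (diff-- n (σ a) a) ⟩
    diff n (Δ a)
  ∎
  where open ≡-Reasoning

-- the integer sequence t ↦ f(s + t), read at p-adic precision k
sample : (Seq → Seq) → Seq → ℕ → ℕ → ℤ
sample f s k t = f (shift s t) k

ΔPow≡diff : ∀ f n s k → ΔPow f n s k ≡ diff n (sample f s k)
ΔPow≡diff f n s k = binomialSum≡diff n (sample f s k)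

binomial-symmetric : ∀ {N l m} → l ℕ.+ m ≡ N → N C l ≡ N C m
binomial-symmetric {N} {l} {m} refl =
  trans (nCk≡nC[n∸k] (ℕP.m≤m+n l m)) (cong (N C_) (ℕP.m+n∸m≡n l m))

pascal : ∀ {N l m} → l ℕ.+ m ≡ suc N → N C m ℕ.+ N C l ≡ suc N C l
pascal {N} {zero}  {m} refl = cong (ℕ._+ 1) (k>n⇒nCk≡0 (ℕP.n<1+n N))
pascal {N} {suc l} {m} l+m≡1+N =
  trans (cong (ℕ._+ N C suc l) (sym (binomial-symmetric {N} {l} {m} (ℕP.suc-injective l+m≡1+N))))
        (nCk+nC[k+1]≡[n+1]C[k+1] N l)

-- Indicator of r < l, used as the extra power of p below order l

[_<_] : ℕ → ℕ → ℕ
[ r     < zero  ] = 0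
[ zero  < suc l ] = 1
[ suc r < suc l ] = [ r < l ]

[<]-≤1 : ∀ r l → [ r < l ] ≤ 1
[<]-≤1 r       zero    = z≤n
[<]-≤1 zero    (suc l) = ℕP.≤-refl
[<]-≤1 (suc r) (suc l) = [<]-≤1 r l

[<]-true : ∀ {r l} → r < l → [ r < l ] ≡ 1
[<]-true {zero}  {suc l} _         = refl
[<]-true {suc r} {suc l} (s≤s r<l) = [<]-true r<l

[<]-false : ∀ {r l} → l ≤ r → [ r < l ] ≡ 0
[<]-false {r}     {zero}  _         = refl
[<]-false {suc r} {suc l} (s≤s l≤r) = [<]-false l≤r

[<]-pred : ∀ r l → [ suc r < l ] ≡ [ r < l ∸ 1 ]
[<]-pred r zero    = refl
[<]-pred r (suc l) = refl

[<]-mono : ∀ r {l l′} → l ≤ l′ → [ r < l ] ≤ [ r < l′ ]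
[<]-mono r       {zero}            _         = z≤n
[<]-mono zero    {suc l} {suc l′} _         = ℕP.≤-refl
[<]-mono (suc r) {suc l} {suc l′} (s≤s l≤l′) = [<]-mono r l≤l′

[0<]-+ : ∀ l m → [ 0 < l ℕ.+ m ] ≤ [ 0 < l ] ℕ.+ [ 0 < m ]
[0<]-+ zero    m = ℕP.≤-refl
[0<]-+ (suc l) m = s≤s z≤n

-- one step of the product rule lowers the order of the left or the
-- right factor, and the indicator of the product follows along
[<]-step-left : ∀ r l m → [ suc r < l ℕ.+ m ] ≤ [ r < (l ∸ 1) ℕ.+ m ]
[<]-step-left r zero    m = ℕP.≤-trans (ℕP.≤-reflexive ([<]-pred r m)) ([<]-mono r (ℕP.m∸n≤m m 1))
[<]-step-left r (suc l) m = ℕP.≤-refl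

[<]-step-right : ∀ r l m → [ suc r < l ℕ.+ m ] ≤ [ r < l ℕ.+ (m ∸ 1) ]
[<]-step-right r l zero    =
  ℕP.≤-trans (ℕP.≤-reflexive ([<]-pred r (l ℕ.+ 0))) ([<]-mono r (ℕP.m∸n≤m (l ℕ.+ 0) 1))
[<]-step-right r l (suc m) = ℕP.≤-reflexive (cong [ suc r <_] (ℕP.+-suc l m))

∣-zero : ∀ {k} → k ∣ℤ 0ℤ
∣-zero = divides 0ℤ refl

∣-* : ∀ {a b x y} → a ∣ℤ x → b ∣ℤ y → a * b ∣ℤ x * y
∣-* {a} {b} {x} a∣x b∣y = ∣-trans (*-monoˡ-∣ b a∣x) (*-monoʳ-∣ x b∣y)

∣-congruence-* : ∀ {d x y x′ y′} → d ∣ℤ x - y → d ∣ℤ x′ - y′ → d ∣ℤ x * x′ - y * y′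
∣-congruence-* {d} {x} {y} {x′} {y′} d∣x-y d∣x′-y′ =
  subst (d ∣ℤ_) (expand x y x′ y′) (∣m∣n⇒∣m+n (∣m⇒∣m*n x′ d∣x-y) (∣n⇒∣m*n y d∣x′-y′))
  where
  expand : ∀ x y x′ y′ → (x - y) * x′ + y * (x′ - y′) ≡ x * x′ - y * y′
  expand = solve-∀

∣-congruent : ∀ {d x y} → d ∣ℤ x - y → d ∣ℤ x ⇔ d ∣ℤ y
∣-congruent {d} {x} {y} d∣x-y = mk⇔
  (λ d∣x → subst (d ∣ℤ_) (cancel x y) (∣m∣n⇒∣m-n d∣x d∣x-y))
  (λ d∣y → subst (d ∣ℤ_) (restore x y) (∣m∣n⇒∣m+n d∣x-y d∣y))
  where
  cancel : ∀ x y → x - (x - y) ≡ y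
  cancel = solve-∀
  restore : ∀ x y → (x - y) + y ≡ x
  restore = solve-∀

module Valuation (p : ℕ) where

  P : ℕ → ℤ
  P e = + (p ℕ.^ e)

  P-+ : ∀ a b → P (a ℕ.+ b) ≡ P a * P b
  P-+ a b = trans (cong +_ (ℕP.^-distribˡ-+-* p a b)) (ℤP.pos-* (p ℕ.^ a) (p ℕ.^ b))

  P-mono : ∀ {a b} → a ≤ b → P a ∣ℤ P b
  P-mono {a} {b} a≤b = subst (λ e → P a ∣ℤ P e) (ℕP.m+[n∸m]≡n a≤b)
    (divides (P (b ∸ a)) (trans (P-+ a (b ∸ a)) (ℤP.*-comm (P a) (P (b ∸ a)))))

  P-suc : ∀ e → P (suc e) ≡ P e * + p
  P-suc e = trans (cong +_ (ℕP.*-comm p (p ℕ.^ e))) (ℤP.pos-* (p ℕ.^ e) p)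

  weaken : ∀ {a b x} → a ≤ b → P b ∣ℤ x → P a ∣ℤ x
  weaken a≤b = ∣-trans (P-mono a≤b)

  record Near (e : ℕ) (U x : ℤ) : Set where
    constructor near
    field gap : P (suc e) ∣ℤ x - P e * U

  Near-+ : ∀ {e U V x y} → Near e U x → Near e V y → Near e (U + V) (x + y)
  Near-+ {e} {U} {V} {x} {y} (near gx) (near gy) =
    near (subst (P (suc e) ∣ℤ_) (regroup x y (P e) U V) (∣m∣n⇒∣m+n gx gy))
    where
    regroup : ∀ x y q U V → (x - q * U) + (y - q * V) ≡ (x + y) - q * (U + V)
    regroup = solve-∀

  Near-zero : ∀ {e x} → Near e 0ℤ x ⇔ P (suc e) ∣ℤ x
  Near-zero {e} {x} = mk⇔
    (λ (near g) → subst (P (suc e) ∣ℤ_) (drop x (P e)) g)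
    (λ h → near (subst (P (suc e) ∣ℤ_) (sym (drop x (P e))) h))
    where
    drop : ∀ x q → x - q * 0ℤ ≡ x
    drop = solve-∀

  Near-exponent : ∀ {e e′ U x} → e ≡ e′ → Near e U x → Near e′ U x
  Near-exponent refl n = n

  Near-coefficient : ∀ {e U U′ x} → U ≡ U′ → Near e U x → Near e U′ x
  Near-coefficient refl n = n

  Near-* : ∀ {e f U V x y} → Near e U x → Near f V y → P f ∣ℤ y → Near (e ℕ.+ f) (U * V) (x * y)
  Near-* {e} {f} {U} {V} {x} {y} (near gx) (near gy) pf∣y = near
    (subst (P (suc (e ℕ.+ f)) ∣ℤ_)
      (trans (expand x y (P e) (P f) U V) (cong (λ q → x * y - q * (U * V)) (sym (P-+ e f))))
      (∣m∣n⇒∣m+n (subst (_∣ℤ (x - P e * U) * y) (sym (P-+ (suc e) f)) (∣-* gx pf∣y))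
                 (subst (_∣ℤ (P e * U) * (y - P f * V)) (sym exponent)
                    (∣-* {P e} (∣m⇒∣m*n U ∣-refl) gy))))
    where
    exponent : P (suc (e ℕ.+ f)) ≡ P e * P (suc f)
    exponent = trans (cong P (sym (ℕP.+-suc e f))) (P-+ e (suc f))
    expand : ∀ x y a b U V → (x - a * U) * y + (a * U) * (y - b * V) ≡ x * y - (a * b) * (U * V)
    expand = solve-∀

  -- Divisibility profiles of integer sequences

  record Divided (M c l : ℕ) (a : ℕ → ℤ) : Set where
    constructor divided
    field at : ∀ r → r ≤ M → P ([ r < l ] ℕ.+ (c ℕ.+ r)) ∣ℤ diff r a
  open Divided public

  record Leading (c l : ℕ) (u : ℤ) (a : ℕ → ℤ) : Set where
    constructor leading
    field leading-term : Near (c ℕ.+ l) u (diff l a)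
  open Leading public

  Divided-lower : ∀ {M c l a} → Divided (suc M) c l a → Divided M c l a
  Divided-lower da = divided λ r r≤M → at da r (ℕP.m≤n⇒m≤1+n r≤M)

  Divided-forget : ∀ {M c l a} → Divided M c l a → Divided M c 0 a
  Divided-forget {l = l} da = divided λ r r≤M →
    weaken (ℕP.m≤n+m (_ ℕ.+ r) [ r < l ]) (at da r r≤M)

  Divided-intro : ∀ {M c l a} → (∀ r → r ≤ M → P (c ℕ.+ r) ∣ℤ diff r a) →
                  (∀ r → r < l → r ≤ M → P (suc (c ℕ.+ r)) ∣ℤ diff r a) → Divided M c l a
  Divided-intro {M} {c} {l} {a} base extra = divided by-order
    where
    by-order : ∀ r → r ≤ M → P ([ r < l ] ℕ.+ (c ℕ.+ r)) ∣ℤ diff r a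
    by-order r r≤M with r ℕ.<? l
    ... | yes r<l = subst (λ i → P (i ℕ.+ (c ℕ.+ r)) ∣ℤ diff r a) (sym ([<]-true r<l))
                          (extra r r<l r≤M)
    ... | no  r≮l = subst (λ i → P (i ℕ.+ (c ℕ.+ r)) ∣ℤ diff r a) (sym ([<]-false (ℕP.≮⇒≥ r≮l)))
                          (base r r≤M)

  Divided-Δ : ∀ {M c l a} → Divided (suc M) c l a → Divided M (suc c) (l ∸ 1) (Δ a)
  Divided-Δ {c = c} {l} da = divided λ r r≤M →
    weaken (ℕP.≤-reflexive (cong₂ ℕ._+_ (sym ([<]-pred r l)) (sym (ℕP.+-suc c r))))
           (at da (suc r) (s≤s r≤M))

  Divided-σ : ∀ {M c l a} → Divided (suc M) c l a → Divided M c l (σ a)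
  Divided-σ {c = c} {l} {a} da = divided λ r r≤M →
    subst (_ ∣ℤ_) (sym (diff-σ r a))
      (∣m∣n⇒∣m+n (at da r (ℕP.m≤n⇒m≤1+n r≤M))
                 (weaken (next-order r) (at da (suc r) (s≤s r≤M))))
    where
    next-order : ∀ r → [ r < l ] ℕ.+ (c ℕ.+ r) ≤ [ suc r < l ] ℕ.+ (c ℕ.+ suc r)
    next-order r = ℕP.≤-trans (ℕP.+-monoˡ-≤ (c ℕ.+ r) ([<]-≤1 r l))
                    (ℕP.≤-trans (ℕP.≤-reflexive (sym (ℕP.+-suc c r)))
                                (ℕP.m≤n+m (c ℕ.+ suc r) [ suc r < l ]))

  Divided-⊙ : ∀ {M c d l m a b} → Divided M c l a → Divided M d m b →
              Divided M (c ℕ.+ d) (l ℕ.+ m) (a ⊙ b)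
  Divided-⊙ {M} {l = l} {m} da db = divided (bound M da db)
    where
    bound : ∀ M {c d a b} → Divided M c l a → Divided M d m b →
            ∀ r → r ≤ M → P ([ r < l ℕ.+ m ] ℕ.+ ((c ℕ.+ d) ℕ.+ r)) ∣ℤ diff r (a ⊙ b)
    bound M {c} {d} da db zero _ =
      weaken (ℕP.≤-trans (ℕP.+-monoˡ-≤ ((c ℕ.+ d) ℕ.+ 0) ([0<]-+ l m))
                         (ℕP.≤-reflexive (regroup [ 0 < l ] [ 0 < m ] c d)))
        (subst (_∣ℤ _) (sym (P-+ ([ 0 < l ] ℕ.+ (c ℕ.+ 0)) ([ 0 < m ] ℕ.+ (d ℕ.+ 0))))
          (∣-* (at da 0 z≤n) (at db 0 z≤n)))
      where
      regroup : ∀ x y c d →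
                (x ℕ.+ y) ℕ.+ ((c ℕ.+ d) ℕ.+ 0) ≡ (x ℕ.+ (c ℕ.+ 0)) ℕ.+ (y ℕ.+ (d ℕ.+ 0))
      regroup = ℕSolver.solve-∀
    bound (suc M) {c} {d} {a} {b} da db (suc r) (s≤s r≤M) =
      subst (_ ∣ℤ_) (sym (leibniz r a b))
        (∣m∣n⇒∣m+n
          (weaken (ℕP.+-mono-≤ ([<]-step-left r l m) (ℕP.≤-reflexive (ℕP.+-suc (c ℕ.+ d) r)))
                  (at (Divided-⊙ (Divided-Δ da) (Divided-σ db)) r r≤M))
          (weaken (ℕP.+-mono-≤ ([<]-step-right r l m) (ℕP.≤-reflexive shift-right))
                  (at (Divided-⊙ (Divided-lower da) (Divided-Δ db)) r r≤M)))
      where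
      shift-right : (c ℕ.+ d) ℕ.+ suc r ≡ (c ℕ.+ suc d) ℕ.+ r
      shift-right = trans (ℕP.+-suc (c ℕ.+ d) r) (sym (cong (ℕ._+ r) (ℕP.+-suc c d)))

  Leading-coefficient : ∀ {c l u u′ a} → u ≡ u′ → Leading c l u a → Leading c l u′ a
  Leading-coefficient refl la = la

  Leading-Δ : ∀ {c l u a} → Leading c (suc l) u a → Leading (suc c) l u (Δ a)
  Leading-Δ {c} {l} la = leading (Near-exponent (ℕP.+-suc c l) (leading-term la))

  -- σ does not change the leading term, since the next difference is
  -- divisible by p^(c + l + 1)
  Leading-σ : ∀ {M c k l u a} → Divided (suc M) c k a → l ≤ M → Leading c l u a → Leading c l u (σ a)
  Leading-σ {c = c} {k} {l} {u} {a} da l≤M la = leading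
    (subst (Near (c ℕ.+ l) u) (sym (diff-σ l a))
      (Near-coefficient (ℤP.+-identityʳ u)
        (Near-+ (leading-term la) (from Near-zero (weaken next-order (at da (suc l) (s≤s l≤M)))))))
    where
    next-order : suc (c ℕ.+ l) ≤ [ suc l < k ] ℕ.+ (c ℕ.+ suc l)
    next-order = ℕP.≤-trans (ℕP.≤-reflexive (sym (ℕP.+-suc c l))) (ℕP.m≤n+m _ [ suc l < k ])

  Leading-below : ∀ {M c l r a} → r < l → r ≤ M → Divided M c l a → Leading c r 0ℤ a
  Leading-below {c = c} {l} {r} r<l r≤M da =
    leading (from Near-zero (subst (λ i → P (i ℕ.+ (c ℕ.+ r)) ∣ℤ _) ([<]-true r<l) (at da r r≤M)))

  -- Induction on the order
  -- via the Leibniz rule; each of its two terms is handled by induction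
  -- or, when its left (resp. right) order is exhausted, vanishes.
  Leading-⊙ : ∀ N {M c d l m u v a b} → l ℕ.+ m ≡ N → N ≤ M →
              Divided M c l a → Divided M d m b → Leading c l u a → Leading d m v b →
              Leading (c ℕ.+ d) N (+ (N C l) * (u * v)) (a ⊙ b)
  Leading-⊙ zero {c = c} {d} {zero} {zero} {u} {v} refl _ _ db la lb = leading
    (Near-coefficient (sym (ℤP.*-identityˡ (u * v)))
      (Near-exponent (regroup c d) (Near-* (leading-term la) (leading-term lb) (at db 0 z≤n))))
    where
    regroup : ∀ c d → (c ℕ.+ 0) ℕ.+ (d ℕ.+ 0) ≡ (c ℕ.+ d) ℕ.+ 0
    regroup = ℕSolver.solve-∀
  Leading-⊙ (suc N) {suc M} {c} {d} {l} {m} {u} {v} {a} {b} l+m≡1+N (s≤s N≤M) da db la lb = leading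
    (subst (Near ((c ℕ.+ d) ℕ.+ suc N) _) (sym (leibniz N a b))
      (Near-coefficient coefficient
        (Near-+ (Near-exponent (sym (ℕP.+-suc (c ℕ.+ d) N)) (leading-term (left-term l+m≡1+N da la)))
                (Near-exponent exponent-right (leading-term (right-term l+m≡1+N db lb))))))
    where
    coefficient : + (N C m) * (u * v) + + (N C l) * (u * v) ≡ + (suc N C l) * (u * v)
    coefficient = trans (sym (ℤP.*-distribʳ-+ (u * v) (+ (N C m)) (+ (N C l))))
                        (cong (_* (u * v)) (trans (sym (ℤP.pos-+ (N C m) (N C l)))
                                                  (cong +_ (pascal {N} {l} {m} l+m≡1+N))))
    exponent-right : (c ℕ.+ suc d) ℕ.+ N ≡ (c ℕ.+ d) ℕ.+ suc N
    exponent-right = trans (cong (ℕ._+ N) (ℕP.+-suc c d)) (sym (ℕP.+-suc (c ℕ.+ d) N))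
    left-term : ∀ {l} → l ℕ.+ m ≡ suc N → Divided (suc M) c l a → Leading c l u a →
                Leading (suc c ℕ.+ d) N (+ (N C m) * (u * v)) (Δ a ⊙ σ b)
    left-term {zero} m≡1+N da _ =
      Leading-coefficient (cong (λ k → + k * (u * v)) (sym (k>n⇒nCk≡0 N<m)))
        (Leading-below N<m N≤M (Divided-⊙ (Divided-Δ da) (Divided-σ db)))
      where
      N<m : N < m
      N<m = ℕP.≤-reflexive (sym m≡1+N)
    left-term {suc l} l+m≡1+N da la =
      Leading-coefficient (cong (λ k → + k * (u * v)) (binomial-symmetric {N} {l} {m} l+m≡N))
        (Leading-⊙ N {l = l} {m} l+m≡N N≤M (Divided-Δ da) (Divided-σ db)
                   (Leading-Δ la) (Leading-σ db m≤M lb))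
      where
      l+m≡N : l ℕ.+ m ≡ N
      l+m≡N = ℕP.suc-injective l+m≡1+N
      m≤M : m ≤ M
      m≤M = ℕP.≤-trans (ℕP.m≤n+m m l) (subst (_≤ M) (sym l+m≡N) N≤M)
    right-term : ∀ {m} → l ℕ.+ m ≡ suc N → Divided (suc M) d m b → Leading d m v b →
                 Leading (c ℕ.+ suc d) N (+ (N C l) * (u * v)) (a ⊙ Δ b)
    right-term {zero} l+0≡1+N db _ =
      Leading-coefficient (cong (λ k → + k * (u * v)) (sym (k>n⇒nCk≡0 N<l)))
        (Leading-below N<l+0 N≤M (Divided-⊙ (Divided-lower da) (Divided-Δ db)))
      where
      N<l+0 : N < l ℕ.+ 0
      N<l+0 = ℕP.≤-reflexive (sym l+0≡1+N)
      N<l : N < l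
      N<l = subst (N <_) (ℕP.+-identityʳ l) N<l+0
    right-term {suc m} l+m≡1+N db lb =
      Leading-⊙ N {l = l} {m} (ℕP.suc-injective (trans (sym (ℕP.+-suc l m)) l+m≡1+N)) N≤M
        (Divided-lower da) (Divided-Δ db) la (Leading-Δ lb)

  prodSeq : (n : ℕ) → (Fin n → ℕ → ℤ) → ℕ → ℤ
  prodSeq n a t = prodℤ n (λ ν → a ν t)

  Divided-prod : ∀ n {M} {lam : Fin n → ℕ} {a : Fin n → ℕ → ℤ} →
                 (∀ ν → Divided M 0 (lam ν) (a ν)) → Divided M 0 (sumℕ n lam) (prodSeq n a)
  Divided-prod zero    da = divided λ where
    zero    _ → ∣-refl
    (suc r) _ → subst (P (suc r) ∣ℤ_) (sym (diff-const r 1ℤ)) ∣-zero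
  Divided-prod (suc n) da = Divided-⊙ (da Fin.zero) (Divided-prod n (da ∘ Fin.suc))

  Leading-prod : ∀ n {M} {lam : Fin n → ℕ} {u : Fin n → ℤ} {a : Fin n → ℕ → ℤ} →
                 sumℕ n lam ≤ M →
                 (∀ ν → Divided M 0 (lam ν) (a ν)) → (∀ ν → Leading 0 (lam ν) (u ν) (a ν)) →
                 Leading 0 (sumℕ n lam) (+ (multinomial n lam) * prodℤ n u) (prodSeq n a)
  Leading-prod zero    _ _ _ = leading (near ∣-zero)
  Leading-prod (suc n) {lam = lam} {u} sum≤M da la =
    Leading-coefficient coefficient
      (Leading-⊙ (l₀ ℕ.+ S) refl sum≤M (da Fin.zero) (Divided-prod n (da ∘ Fin.suc)) (la Fin.zero)
        (Leading-prod n (ℕP.≤-trans (ℕP.m≤n+m S l₀) sum≤M) (da ∘ Fin.suc) (la ∘ Fin.suc)))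
    where
    l₀ S : ℕ
    l₀ = lam Fin.zero
    S = sumℕ n (lam ∘ Fin.suc)
    regroup : ∀ c u M U → c * (u * (M * U)) ≡ (c * M) * (u * U)
    regroup = solve-∀
    multinomial′ : ℕ
    multinomial′ = multinomial n (lam ∘ Fin.suc)
    coefficient : + ((l₀ ℕ.+ S) C l₀) * (u Fin.zero * (+ multinomial′ * prodℤ n (u ∘ Fin.suc)))
                  ≡ + (multinomial (suc n) lam) * prodℤ (suc n) u
    coefficient =
      trans (regroup (+ ((l₀ ℕ.+ S) C l₀)) (u Fin.zero) (+ multinomial′) (prodℤ n (u ∘ Fin.suc)))
            (cong (_* prodℤ (suc n) u) (sym (ℤP.pos-* ((l₀ ℕ.+ S) C l₀) multinomial′)))

  record Coherent (x : Seq) : Set where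
    constructor coherent-by
    field step : ∀ k → P k ∣ℤ x (suc k) - x k
  open Coherent public

  coherent : ∀ x → IsZp p x → Coherent x
  coherent x zx = coherent-by λ k → ∣ᵤ⇒∣ (zx k)

  isZp : ∀ {x} → Coherent x → IsZp p x
  isZp cx k = ∣⇒∣ᵤ (step cx k)

  coherent-const : ∀ c → Coherent (λ _ → c)
  coherent-const c = coherent-by λ k → subst (P k ∣ℤ_) (sym (ℤP.+-inverseʳ c)) ∣-zero

  coherent-- : ∀ {x y} → Coherent x → Coherent y → Coherent (λ k → x k - y k)
  coherent-- {x} {y} cx cy = coherent-by λ k →
    subst (P k ∣ℤ_) (regroup (x (suc k)) (x k) (y (suc k)) (y k)) (∣m∣n⇒∣m-n (step cx k) (step cy k))
    where
    regroup : ∀ a b c d → (a - b) - (c - d) ≡ (a - c) - (b - d)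
    regroup = solve-∀

  coherent-shift : ∀ {s} ν → Coherent s → Coherent (shift s ν)
  coherent-shift {s} ν cs = coherent-by λ k → subst (P k ∣ℤ_) (regroup (s (suc k)) (s k) (+ ν)) (step cs k)
    where
    regroup : ∀ a b c → a - b ≡ (a + c) - (b + c)
    regroup = solve-∀

  coherent-diff : ∀ r (g : ℕ → Seq) → (∀ t → Coherent (g t)) → Coherent (λ k → diff r (λ t → g t k))
  coherent-diff zero    g cg = cg 0
  coherent-diff (suc r) g cg =
    coherent-diff r (λ t k → g (suc t) k - g t k) (λ t → coherent-- (cg (suc t)) (cg t))

  coherent-stable : ∀ {x} → Coherent x → ∀ {r N} → r ≤ N → P r ∣ℤ x N - x r
  coherent-stable {x} cx {r} {N} r≤N =
    subst (λ N → P r ∣ℤ x N - x r) (ℕP.m∸n+n≡m r≤N) (telescope (N ∸ r))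
    where
    telescope : ∀ d → P r ∣ℤ x (d ℕ.+ r) - x r
    telescope zero    = subst (P r ∣ℤ_) (sym (ℤP.+-inverseʳ (x r))) ∣-zero
    telescope (suc d) =
      subst (P r ∣ℤ_) (chain (x (suc (d ℕ.+ r))) (x (d ℕ.+ r)) (x r))
        (∣m∣n⇒∣m+n (weaken (ℕP.m≤n+m r d) (step cx (d ℕ.+ r))) (telescope d))
      where
      chain : ∀ a b c → (a - b) + (b - c) ≡ a - c
      chain = solve-∀

  coherent-divisible : ∀ {x} → Coherent x → ∀ {r N} → r ≤ N → P r ∣ℤ x r → P r ∣ℤ x N
  coherent-divisible {x} cx {r} {N} r≤N p^r∣xr =
    subst (P r ∣ℤ_) (cancel (x N) (x r)) (∣m∣n⇒∣m+n (coherent-stable cx r≤N) p^r∣xr)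
    where
    cancel : ∀ a b → (a - b) + b ≡ a
    cancel = solve-∀

  coherent-ΔPow : ∀ f {s} → ZpFun p f → Coherent s → ∀ n → Coherent (ΔPow f n s)
  coherent-ΔPow f {s} zf cs n = coherent-by λ k →
    subst (P k ∣ℤ_) (sym (cong₂ _-_ (ΔPow≡diff f n s (suc k)) (ΔPow≡diff f n s k)))
      (step (coherent-diff n (λ t → f (shift s t))
              (λ t → coherent _ (proj₁ zf (shift s t) (isZp (coherent-shift t cs))))) k)

  K-divided : ∀ f {s} → K p f → Coherent s → ∀ M → Divided M 0 0 (sample f s M)
  K-divided f {s} kf cs M = divided λ r r≤M →
    subst (P r ∣ℤ_) (ΔPow≡diff f r s M)
      (coherent-divisible (coherent-ΔPow f (proj₁ kf) cs r) r≤M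
        (∣ᵤ⇒∣ (proj₂ kf s (isZp cs) r)))

  coherent-prodFun : ∀ n (f : Fin n → Seq → Seq) → (∀ ν → ZpFun p (f ν)) →
                     ∀ x → IsZp p x → Coherent (prodFun n f x)
  coherent-prodFun zero    f zf x zx = coherent-const 1ℤ
  coherent-prodFun (suc n) f zf x zx = coherent-by λ k →
    ∣-congruence-* {x = f Fin.zero x (suc k)} {f Fin.zero x k}
                   (step (coherent (f Fin.zero x) (proj₁ (zf Fin.zero) x zx)) k)
                   (step (coherent-prodFun n (f ∘ Fin.suc) (zf ∘ Fin.suc) x zx) k)

  prodFun-respects : ∀ n (f : Fin n → Seq → Seq) → (∀ ν → ZpFun p (f ν)) →
                     ∀ x y → IsZp p x → IsZp p y → x ≈[ p ] y →
                     ∀ k → P k ∣ℤ prodFun n f x k - prodFun n f y k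
  prodFun-respects zero    f zf x y zx zy x≈y k = ∣-zero
  prodFun-respects (suc n) f zf x y zx zy x≈y k =
    ∣-congruence-* {x = f Fin.zero x k} {f Fin.zero y k}
                   (∣ᵤ⇒∣ (proj₂ (zf Fin.zero) x y zx zy x≈y k))
                   (prodFun-respects n (f ∘ Fin.suc) (zf ∘ Fin.suc) x y zx zy x≈y k)

  K-prod : ∀ n {f : Fin n → Seq → Seq} → (∀ ν → K p (f ν)) → K p (prodFun n f)
  K-prod n {f} kf =
    ( (λ x zx → isZp (coherent-prodFun n f zf x zx))
    , (λ x y zx zy x≈y k → ∣⇒∣ᵤ (prodFun-respects n f zf x y zx zy x≈y k)) )
    , λ s zs N → ∣⇒∣ᵤ (subst (P N ∣ℤ_) (sym (ΔPow≡diff (prodFun n f) N s N))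
                   (at (Divided-forget (Divided-prod n (λ ν → K-divided (f ν) (kf ν) (coherent s zs) N)))
                       N ℕP.≤-refl))
    where
    zf : ∀ ν → ZpFun p (f ν)
    zf ν = proj₁ (kf ν)

-- Leading p-adic digits

remainder-zero : ∀ {d r} → r < d → d ℕ∣.∣ r → r ≡ 0
remainder-zero {r = zero}  _   _   = refl
remainder-zero {r = suc r} r<d d∣r = ⊥-elim (ℕ∣.>⇒∤ r<d d∣r)

module Digits (p : ℕ) .{{_ : NonZero p}} where
  open Valuation p

  exact-quotient : ∀ e x → P e ∣ℤ x → x ≡ P e * _/ℕ_ x (p ℕ.^ e) {{ℕP.m^n≢0 p e}}
  exact-quotient e x p^e∣x = begin
      x             ≡⟨ division ⟩
      + r + q * P e ≡⟨ cong (λ i → + i + q * P e) r≡0 ⟩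
      0ℤ + q * P e  ≡⟨ ℤP.+-identityˡ (q * P e) ⟩
      q * P e       ≡⟨ ℤP.*-comm q (P e) ⟩
      P e * q       ∎
    where
    open ≡-Reasoning
    instance
      p^e≢0 : NonZero (p ℕ.^ e)
      p^e≢0 = ℕP.m^n≢0 p e
    q : ℤ
    q = x /ℕ (p ℕ.^ e)
    r : ℕ
    r = x %ℕ (p ℕ.^ e)
    division : x ≡ + r + q * P e
    division = a≡a%ℕn+[a/ℕn]*n x (p ℕ.^ e)
    cancel : ∀ a b → (a + b) - b ≡ a
    cancel = solve-∀
    p^e∣r : P e ∣ℤ + r
    p^e∣r = subst (P e ∣ℤ_) (trans (cong (_- q * P e) division) (cancel (+ r) (q * P e)))
                  (∣m∣n⇒∣m-n p^e∣x (∣n⇒∣m*n q ∣-refl))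
    r≡0 : r ≡ 0
    r≡0 = remainder-zero (n%ℕd<d x (p ℕ.^ e)) (∣⇒∣ᵤ p^e∣r)

  -- the leading digit p^(-e) y(e+1) of a coherent y with p^e ∣ y
  digit : Seq → ℕ → ℤ
  digit y e = _/ℕ_ (y (suc e)) (p ℕ.^ e) {{ℕP.m^n≢0 p e}}

  digit-near : ∀ {y e N U} → Coherent y → P e ∣ℤ y e → suc e ≤ N →
               Near e U (y N) ⇔ + p ∣ℤ digit y e - U
  digit-near {y} {e} {N} {U} cy p^e∣ye e<N = mk⇔
    (λ (near g) → *-cancelˡ-∣ (P e) {{ℕP.m^n≢0 p e}}
       (subst (_∣ℤ P e * (q - U)) (P-suc e) (∣m+n∣m⇒∣n (subst (P (suc e) ∣ℤ_) split g) head)))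
    (λ p∣q-U → near (subst (P (suc e) ∣ℤ_) (sym split)
       (∣m∣n⇒∣m+n head (subst (_∣ℤ P e * (q - U)) (sym (P-suc e)) (*-monoʳ-∣ (P e) p∣q-U)))))
    where
    q : ℤ
    q = digit y e
    y-next : y (suc e) ≡ P e * q
    y-next = exact-quotient e (y (suc e)) (coherent-divisible cy (ℕP.n≤1+n e) p^e∣ye)
    head : P (suc e) ∣ℤ y N - y (suc e)
    head = coherent-stable cy e<N
    regroup : ∀ a b q U → a - b * U ≡ (a - b * q) + b * (q - U)
    regroup = solve-∀
    split : y N - P e * U ≡ (y N - y (suc e)) + P e * (q - U)
    split = trans (regroup (y N) (P e) q U) (cong (λ z → (y N - z) + P e * (q - U)) (sym y-next))

  nonunit⇔ : ∀ x → (¬ Unit p x) ⇔ (+ p ∣ℤ x 1)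
  nonunit⇔ x = mk⇔ (∣ᵤ⇒∣ ∘ decidable-stable (p ℕ∣.∣? ∣ x 1 ∣))
                   (λ p∣x unit → unit (∣⇒∣ᵤ p∣x))

  zero-coherent : Coherent (const 0)
  zero-coherent = coherent-const (+ 0)

  K-digit : ∀ g {j N U} → K p g → j < N →
            Near j U (diff j (sample g (const 0) N)) ⇔ + p ∣ℤ Δf p g j 1 - U
  K-digit g {j} {N} {U} kg j<N = mk⇔
    (to digit-criterion ∘ subst (Near j U) (sym (ΔPow≡diff g j (const 0) N)))
    (subst (Near j U) (ΔPow≡diff g j (const 0) N) ∘ from digit-criterion)
    where
    digit-criterion : Near j U (ΔPow g j (const 0) N) ⇔ + p ∣ℤ Δf p g j 1 - U
    digit-criterion = digit-near (coherent-ΔPow g (proj₁ kg) zero-coherent j)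
                                 (∣ᵤ⇒∣ (proj₂ kg (const 0) (isZp zero-coherent) j)) j<N

  K-digit-zero : ∀ g {j N} → K p g → j < N →
                 P (suc j) ∣ℤ diff j (sample g (const 0) N) ⇔ + p ∣ℤ Δf p g j 1
  K-digit-zero g {j} kg j<N = mk⇔
    (λ h → subst (+ p ∣ℤ_) (ℤP.+-identityʳ _) (to (K-digit g kg j<N) (from Near-zero h)))
    (λ h → to Near-zero (from (K-digit g kg j<N) (subst (+ p ∣ℤ_) (sym (ℤP.+-identityʳ _)) h)))

  K-leading : ∀ g {l M} → K p g → l < M → Leading 0 l (Δf p g l 1) (sample g (const 0) M)
  K-leading g {l} kg l<M =
    leading (from (K-digit g kg l<M) (subst (+ p ∣ℤ_) (sym (ℤP.+-inverseʳ (Δf p g l 1))) ∣-zero))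

  λ-divided : ∀ g {l M} → K p g → IsLambda p g l → l ≤ M → Divided M 0 l (sample g (const 0) M)
  λ-divided g {M = M} kg (_ , below-λ) l≤M =
    Divided-intro (at (K-divided g kg zero-coherent M))
      (λ r r<l _ → from (K-digit-zero g kg (ℕP.<-≤-trans r<l l≤M))
                        (to (nonunit⇔ (Δf p g r)) (below-λ r r<l)))

  divided-nonunit : ∀ g {l M} → K p g → Divided M 0 l (sample g (const 0) M) →
                    ∀ j → j < l → j < M → ¬ Unit p (Δf p g j)
  divided-nonunit g kg dg j j<l j<M unit =
    from (nonunit⇔ (Δf p g j))
      (to (K-digit-zero g kg j<M) (subst (λ i → P (i ℕ.+ j) ∣ℤ _) ([<]-true j<l) (at dg j (ℕP.<⇒≤ j<M))))
      unit

  leading-digit : ∀ g {l M u} → K p g → l < M → Leading 0 l u (sample g (const 0) M) →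
                  + p ∣ℤ Δf p g l 1 - u
  leading-digit g kg l<M lg = to (K-digit g kg l<M) (leading-term lg)

  λ-bound : ∀ g {m} → (∀ j → j < m → ¬ Unit p (Δf p g j)) → ∀ k → IsLambda p g k → m ≤ k
  λ-bound g nonunits k (unit , _) = ℕP.≮⇒≥ (λ k<m → nonunits k k<m unit)

  λ-exceeds : ∀ g {m} → (∀ j → j < m → ¬ Unit p (Δf p g j)) →
              (∀ k → IsLambda p g k → m < k) ⇔ (¬ Unit p (Δf p g m))
  λ-exceeds g {m} nonunits = mk⇔
    (λ λ>m unit → ℕP.<-irrefl refl (λ>m m (unit , nonunits)))
    (λ nonunit k isλ → ℕP.≤∧≢⇒< (λ-bound g nonunits k isλ)
       (λ m≡k → nonunit (subst (λ i → Unit p (Δf p g i)) (sym m≡k) (proj₁ isλ))))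

prime-∤-prodℤ : ∀ {p} → Prime p → ∀ n (u : Fin n → ℤ) →
                (∀ ν → ¬ p ∣ ∣ u ν ∣) → ¬ p ∣ ∣ prodℤ n u ∣
prime-∤-prodℤ pr zero    u _ p∣1 = ¬prime[1] (subst Prime (ℕ∣.∣1⇒≡1 p∣1) pr)
prime-∤-prodℤ {p} pr (suc n) u p∤u p∣prod
  with euclidsLemma ∣ u Fin.zero ∣ ∣ prodℤ n (u ∘ Fin.suc) ∣ pr
         (subst (p ∣_) (ℤP.abs-* (u Fin.zero) (prodℤ n (u ∘ Fin.suc))) p∣prod)
... | inj₁ p∣u₀   = p∤u Fin.zero p∣u₀
... | inj₂ p∣rest = prime-∤-prodℤ pr n (u ∘ Fin.suc) (p∤u ∘ Fin.suc) p∣rest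

coefficient-criterion : ∀ {p} → Prime p → ∀ c n (u : Fin n → ℤ) → (∀ ν → ¬ p ∣ ∣ u ν ∣) →
                        (p ∣ c) ⇔ (+ p ∣ℤ + c * prodℤ n u)
coefficient-criterion {p} pr c n u p∤u = mk⇔
  (λ p∣c → ∣ᵤ⇒∣ (subst (p ∣_) (sym abs-product) (ℕ∣.∣m⇒∣m*n ∣ prodℤ n u ∣ p∣c)))
  (λ p∣cu → case-split (euclidsLemma c ∣ prodℤ n u ∣ pr (subst (p ∣_) abs-product (∣⇒∣ᵤ p∣cu))))
  where
  abs-product : ∣ + c * prodℤ n u ∣ ≡ c ℕ.* ∣ prodℤ n u ∣
  abs-product = ℤP.abs-* (+ c) (prodℤ n u)
  case-split : (p ∣ c) ⊎ (p ∣ ∣ prodℤ n u ∣) → p ∣ c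
  case-split (inj₁ p∣c)    = p∣c
  case-split (inj₂ p∣prod) = ⊥-elim (prime-∤-prodℤ pr n u p∤u p∣prod)

term≤sumℕ : ∀ n (a : Fin n → ℕ) ν → a ν ≤ sumℕ n a
term≤sumℕ (suc n) a Fin.zero    = ℕP.m≤m+n (a Fin.zero) _
term≤sumℕ (suc n) a (Fin.suc ν) =
  ℕP.≤-trans (term≤sumℕ n (a ∘ Fin.suc) ν) (ℕP.m≤n+m _ (a Fin.zero))

proposition6p10 : (p : ℕ) .{{_ : NonZero p}} → Prime p →
    (n : ℕ) → 1 ≤ n →
    (f : Fin n → Seq → Seq) → (lam : Fin n → ℕ) →
    (∀ ν → K p (f ν)) → (∀ ν → IsLambda p (f ν) (lam ν)) →
    K p (prodFun n f)
    × (∀ k → IsLambda p (prodFun n f) k → sumℕ n lam ≤ k)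
    × CongPow p 1 (Δf p (prodFun n f) (sumℕ n lam))
        (λ j → + (multinomial n lam) * prodℤ n (λ ν → Δf p (f ν) (lam ν) j))
    × ((∀ k → IsLambda p (prodFun n f) k → sumℕ n lam < k) ⇔ (p ∣ multinomial n lam))
proposition6p10 p pr n _ f lam kf isλ =
  kF , λ-bound F nonunits , congruence , criterion
  where
  open Valuation p
  open Digits p
  m : ℕ
  m = sumℕ n lam
  F : Seq → Seq
  F = prodFun n f
  kF : K p F
  kF = K-prod n kf
  u : Fin n → ℤ
  u ν = Δf p (f ν) (lam ν) 1
  U : ℤ
  U = + (multinomial n lam) * prodℤ n u
  -- at precision m + 1 the factors have their profiles and leading terms,
  -- which the product rule transfers to F
  divided-f : ∀ ν → Divided (suc m) 0 (lam ν) (sample (f ν) (const 0) (suc m))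
  divided-f ν = λ-divided (f ν) (kf ν) (isλ ν) (ℕP.m≤n⇒m≤1+n (term≤sumℕ n lam ν))
  divided-F : Divided (suc m) 0 m (sample F (const 0) (suc m))
  divided-F = Divided-prod n divided-f
  leading-F : Leading 0 m U (sample F (const 0) (suc m))
  leading-F = Leading-prod n (ℕP.n≤1+n m) divided-f
                (λ ν → K-leading (f ν) (kf ν) (s≤s (term≤sumℕ n lam ν)))
  nonunits : ∀ j → j < m → ¬ Unit p (Δf p F j)
  nonunits j j<m = divided-nonunit F kF divided-F j j<m (ℕP.m≤n⇒m≤1+n j<m)
  digit-F : + p ∣ℤ Δf p F m 1 - U
  digit-F = leading-digit F kF (ℕP.n<1+n m) leading-F
  congruence : CongPow p 1 (Δf p F m) (λ j → + (multinomial n lam) * prodℤ n (λ ν → Δf p (f ν) (lam ν) j))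
  congruence = ∣⇒∣ᵤ (subst (λ d → + d ∣ℤ Δf p F m 1 - U) (sym (ℕP.*-identityʳ p)) digit-F)
  criterion : (∀ k → IsLambda p F k → m < k) ⇔ (p ∣ multinomial n lam)
  criterion = ⇔.trans (λ-exceeds F nonunits)
             (⇔.trans (nonunit⇔ (Δf p F m))
             (⇔.trans (∣-congruent digit-F)
                      (⇔.sym (coefficient-criterion pr (multinomial n lam) n u (λ ν → proj₁ (isλ ν))))))
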